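{- Let $G$ be a bi-block graph with $N$ vertices and $r$ blocks $K_{m_k,n_k}$ ($k=1,\dots,r$), let $q$ be a nonzero scalar with $q\neq -1$ and $q^2(m_k-1)(n_k-1)\neq 1$ for all $k$, let $\mathscr{D}$ be the $q$-distance matrix of $G$, and let $\mathbf{x}$ and $\lambda_G$ be as defined below. Then $\mathscr{D}\mathbf{x}=\lambda_G\mathds{1}_N$, where $\mathds{1}_N$ is the all-ones vector.
   Context: $q$ is a real or complex number (the paper calls it an indeterminate). For an integer $\alpha\ge1$, $[\alpha]=1+q+\cdots+q^{\alpha-1}$, $[0]=0$; the $q$-distance matrix $\mathscr{D}$ of a connected graph with vertices $v_1,\dots,v_N$ has $(i,j)$ entry $[d(v_i,v_j)]$, $d$ the shortest-path distance. A bi-block graph is a connected graph each of whose blocks (maximal connected subgraphs without a cut-vertex) is complete bipartite; its blocks are $K_{m_k,n_k}$ with a fixed bipartition $X_k\cup Y_k$, $|X_k|=m_k$, $|Y_k|=n_k$. For a vertex $v$ let $\hat d(v)$ be the number of blocks containing $v$; put $\Delta_k=q^2(m_k-1)(n_k-1)-1$. Define $$\mathbf{x}(v)=\sum_{k:\,v\in X_k}\frac{q(n_k-1)-1}{(q+1)\Delta_k}+\sum_{k:\,v\in Y_k}\frac{q(m_k-1)-1}{(q+1)\Delta_k}-(\hat d(v)-1),$$ $\mathbf{x}_i=\mathbf{x}(v_i)$, and $$\lambda_G=\sum_{k=1}^r\frac{(q+1)^2(m_k-1)(n_k-1)-m_kn_k}{(q+1)\left(q^2(m_k-1)(n_k-1)-1\right)}.$$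 -}

module Defs where

open import Level using (Level; _⊔_) renaming (suc to lsuc)
open import Algebra.Bundles using (CommutativeRing; Semiring)
import Algebra.Definitions.RawSemiring as RS
open import Data.Bool using (Bool; true; false; if_then_else_)
open import Data.Nat using (ℕ; zero; suc; _∸_; _≤_) renaming (_*_ to _*ℕ_)
open import Data.Fin using (Fin)
open import Data.Fin.Subset using (Subset; _∈_; _⊆_; _∪_; _∩_; ⊤; ⊥; ∣_∣; Nonempty)
open import Data.Fin.Subset using () renaming (_-_ to _∖_)
open import Data.Vec using (lookup; tabulate)
open import Data.Product using (Σ; ∃; _×_)
open import Data.Sum using (_⊎_)
open import Relation.Nullary using (¬_)
open import Relation.Binary.PropositionalEquality using (_≡_)
open import Function.Bundles using (_⇔_)

-- Fields (the stdlib has no Field bundle).  A field is a nontrivial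
-- commutative ring with an inverse for every nonzero element; the
-- value of _⁻¹ at 0# is irrelevant (ℝ and ℂ are instances).

record Field (c ℓ : Level) : Set (lsuc (c ⊔ ℓ)) where
  field
    commutativeRing : CommutativeRing c ℓ
  open CommutativeRing commutativeRing public
  field
    _⁻¹        : Carrier → Carrier
    0≉1        : ¬ (0# ≈ 1#)
    ⁻¹-inverse : ∀ x → ¬ (x ≈ 0#) → x * (x ⁻¹) ≈ 1#

record Graph (N : ℕ) : Set where
  field
    adj     : Fin N → Fin N → Bool
    adj-sym : ∀ u v → adj u v ≡ adj v u
    irrefl  : ∀ u → adj u u ≡ false

module _ {N : ℕ} (G : Graph N) where
  open Graph G

  Edge : Fin N → Fin N → Set
  Edge u v = adj u v ≡ true

  data WalkIn (S : Subset N) : Fin N → Fin N → ℕ → Set where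
    here : ∀ {u} → u ∈ S → WalkIn S u u 0
    step : ∀ {u w v k} → u ∈ S → Edge u w → WalkIn S w v k → WalkIn S u v (suc k)

  ConnectedIn : Subset N → Set
  ConnectedIn S = ∀ u v → u ∈ S → v ∈ S → ∃ λ k → WalkIn S u v k

  Connected : Set
  Connected = ConnectedIn ⊤

  IsDistance : Fin N → Fin N → ℕ → Set
  IsDistance u v d = WalkIn ⊤ u v d × (∀ k → WalkIn ⊤ u v k → d ≤ k)

  NoCutVertex : Subset N → Set
  NoCutVertex S = ∀ v → v ∈ S → ConnectedIn (S ∖ v)

  IsBlock : Subset N → Set
  IsBlock S = Nonempty S × ConnectedIn S × NoCutVertex S
            × (∀ T → S ⊆ T → ConnectedIn T → NoCutVertex T → T ≡ S)

  -- G is a bi-block graph whose blocks are exactly the r (distinct)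
  -- subgraphs G[X k ∪ Y k], each complete bipartite K_{|X k|,|Y k|}
  -- with bipartition X k ∪ Y k.
  record IsBiBlock (r : ℕ) (X Y : Fin r → Subset N) : Set where
    field
      connected   : Connected
      X-nonempty  : ∀ k → Nonempty (X k)
      Y-nonempty  : ∀ k → Nonempty (Y k)
      disjoint    : ∀ k → X k ∩ Y k ≡ ⊥
      bipartite   : ∀ k u v → u ∈ X k ∪ Y k → v ∈ X k ∪ Y k →
                    Edge u v ⇔ ((u ∈ X k × v ∈ Y k) ⊎ (u ∈ Y k × v ∈ X k))
      is-block    : ∀ k → IsBlock (X k ∪ Y k)
      all-blocks  : ∀ S → IsBlock S → ∃ λ k → S ≡ X k ∪ Y k
      distinct    : ∀ k l → X k ∪ Y k ≡ X l ∪ Y l → k ≡ l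

module _ {c ℓ : Level} (F : Field c ℓ) where
  open Field F
  open RS (Semiring.rawSemiring semiring) using (sum; _^_) renaming (_×_ to _·_)

  ι : ℕ → Carrier
  ι n = n · 1#

  infixl 7 _/_
  _/_ : Carrier → Carrier → Carrier
  x / y = x * (y ⁻¹)

  qint : Carrier → ℕ → Carrier
  qint q zero    = 0#
  qint q (suc α) = qint q α + q ^ α

  qmn : Carrier → ℕ → ℕ → Carrier
  qmn q m n = q ^ 2 * ι ((m ∸ 1) *ℕ (n ∸ 1))

  Δ : Carrier → ℕ → ℕ → Carrier
  Δ q m n = qmn q m n - 1#

  module _ {N r : ℕ} (X Y : Fin r → Subset N) where
    m n : Fin r → ℕ
    m k = ∣ X k ∣
    n k = ∣ Y k ∣

  module _ {N r : ℕ} (X Y : Fin r → Subset N) (q : Carrier) where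

    dhat : Fin N → ℕ
    dhat v = ∣ tabulate (λ k → lookup (X k ∪ Y k) v) ∣

    xvec : Fin N → Carrier
    xvec v =
        sum (λ k → if lookup (X k) v
                   then (q * ι (n X Y k ∸ 1) - 1#) / ((q + 1#) * Δ q (m X Y k) (n X Y k))
                   else 0#)
      + sum (λ k → if lookup (Y k) v
                   then (q * ι (m X Y k ∸ 1) - 1#) / ((q + 1#) * Δ q (m X Y k) (n X Y k))
                   else 0#)
      - (ι (dhat v) - 1#)

    λG : Carrier
    λG = sum (λ k → ((q + 1#) ^ 2 * ι ((m X Y k ∸ 1) *ℕ (n X Y k ∸ 1)) - ι (m X Y k *ℕ n X Y k))
                    / ((q + 1#) * Δ q (m X Y k) (n X Y k)))

  qDist : {N : ℕ} → Carrier → (Fin N → Fin N → ℕ) → Fin N → Fin N → Carrier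
  qDist q d i j = qint q (d i j)

  mulVec : {N : ℕ} → (Fin N → Fin N → Carrier) → (Fin N → Carrier) → Fin N → Carrier
  mulVec A x i = sum (λ j → A i j * x j)

{-# OPTIONS --safe #-}
-- Fix the vertex i. Each block B_k = X_k ∪ Y_k has a gate w_k, its vertex nearest to i, and
-- d(i,j) = d(i,w_k) + d(w_k,j) for every j ∈ B_k: a walk that leaves a block along an edge a–c can
-- re-enter it only through a, for otherwise the block together with a simple path from a back into it
-- would be a larger connected set without cut vertex. Every j ≠ i is a non-gate vertex of exactly one
-- block, so x_j = Σ_k ψ_k(j) with ψ_k = a_k[X_k] + b_k[Y_k] − [w_k], and (Dx)_i splits into block sums.
-- Inside K_{m,n} the distances from w_k are 0, 1 and 2, so [D + e] = [D] + q^D [e] turns the block sum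
-- into [D](ma + nb − 1) + q^D((1 + q)(m − 1)a + nb) when w_k ∈ X_k. The two brackets are (1 − q)λ_k
-- and λ_k, and [D](1 − q) + q^D = 1.
module Submission where

open import Defs
open import Level using (Level)
open import Algebra.Bundles using (CommutativeRing; Semiring)
import Algebra.Definitions.RawSemiring as RawSemiringDefinitions
open import Data.Bool using (Bool; true; false; if_then_else_)
open import Data.Empty using (⊥-elim)
open import Data.Fin as Fin using (Fin)
open import Data.Fin.Properties using (any?; punchInᵢ≢i)
open import Data.Fin.Subset using (Subset; _∈_; _∉_; _⊆_; _⊃_; _∪_; ⁅_⁆; ⊤; ∣_∣; Nonempty)
  renaming (_-_ to _∖_)
open import Data.Fin.Subset.Induction using (⊃-wellFounded; Acc; acc)
open import Data.Fin.Subset.Properties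
  using (_∈?_; ∈⊤; ⊆⊤; ∉⊥; x∈⁅x⁆; x∈⁅y⁆⇒x≡y; ∣⁅x⁆∣≡1; x∈p∩q⁺; x∈p∪q⁺; x∈p∪q⁻; x∈p∧x≢y⇒x∈p-y;
         p─q⊆p; ⊆-antisym; x∈p⇒∣p-x∣<∣p∣)
open import Data.Nat as ℕ using (ℕ; zero; suc; _∸_; _≤_; _<_; z≤n; s≤s)
import Data.Nat.Properties as ℕ
open import Data.Nat.Induction using (<-wellFounded)
open import Data.Product using (∃; ∃₂; _×_; _,_; proj₁; proj₂)
open import Data.Sum using (_⊎_; inj₁; inj₂)
open import Data.Unit using (tt) renaming (⊤ to Unit)
open import Data.Vec using (lookup; tabulate; _∷_; []; there)
open import Data.Vec.Properties using (lookup∘tabulate; []=⇒lookup; lookup⇒[]=)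
open import Function using (_∘_)
open import Function.Bundles using (Equivalence)
open import Relation.Nullary using (¬_; Dec; yes; no; does)
open import Relation.Nullary.Decidable using (dec-true; decidable-stable; _×-dec_; ¬?)
open import Relation.Unary using (Pred; Decidable)
open import Relation.Binary.PropositionalEquality as ≡ using (_≡_; _≢_)

-- Integer coefficients let the normaliser cancel constants (1 - 1 ≈ 0), which coefficients drawn
-- from R itself cannot.
module IntegerRingSolver {c ℓ : Level} (R : CommutativeRing c ℓ) where
  open CommutativeRing R
  open import Algebra.Definitions.RawMonoid +-rawMonoid using (_×′_)
  open import Algebra.Properties.Monoid.Mult.TCOptimised +-monoid using (×-homo-+)
  open import Algebra.Properties.Semiring.Mult.TCOptimised semiring using (×1-homo-*)
  open import Algebra.Properties.Ring ring using (-1*x≈-x)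
  open import Algebra.Properties.AbelianGroup +-abelianGroup using (⁻¹-∙-comm)
  open import Algebra.Properties.Group +-group using (⁻¹-involutive; ε⁻¹≈ε)
  open import Algebra.Solver.Ring.AlmostCommutativeRing
    using (AlmostCommutativeRing; fromCommutativeRing; _-Raw-AlmostCommutative⟶_)
  open import Algebra.Properties.CommutativeSemigroup +-commutativeSemigroup
    using () renaming (interchange to +-interchange)
  open import Algebra.Properties.CommutativeSemigroup *-commutativeSemigroup
    using () renaming (interchange to *-interchange)
  open import Data.Maybe using (Maybe; just; nothing)
  open import Data.Integer as ℤ using (ℤ; +_; -[1+_]; _⊖_; sign; _◃_)
  import Data.Integer.Properties as ℤ
  open import Data.Sign as Sign using (Sign)
  open import Relation.Binary.Reasoning.Setoid setoid

  private
    -- _×′_ makes ⟦ + 1 ⟧ reduce to 1#, so solved equations match goals written with 1#.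
    ⟦_⟧ : ℤ → Carrier
    ⟦ + n ⟧      = n ×′ 1#
    ⟦ -[1+ n ] ⟧ = - (suc n ×′ 1#)

    neg-distrib-+ : ∀ x y → - (x + y) ≈ - x + - y
    neg-distrib-+ x y = sym (⁻¹-∙-comm x y)

    x-0≈x : ∀ x → x - 0# ≈ x
    x-0≈x x = trans (+-congˡ ε⁻¹≈ε) (+-identityʳ x)

    [z+x]-[z+y]≈x-y : ∀ z x y → (z + x) - (z + y) ≈ x - y
    [z+x]-[z+y]≈x-y z x y = begin
      (z + x) - (z + y)    ≈⟨ +-congˡ (neg-distrib-+ z y) ⟩
      (z + x) + (- z - y)  ≈⟨ +-interchange z x (- z) (- y) ⟩
      (z - z) + (x - y)    ≈⟨ +-congʳ (-‿inverseʳ z) ⟩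
      0# + (x - y)         ≈⟨ +-identityˡ (x - y) ⟩
      x - y                ∎

    ⊖-homo : ∀ m n → ⟦ m ⊖ n ⟧ ≈ m ×′ 1# - n ×′ 1#
    ⊖-homo m       zero    = sym (x-0≈x (m ×′ 1#))
    ⊖-homo zero    (suc n) = sym (+-identityˡ _)
    ⊖-homo (suc m) (suc n) = begin
      ⟦ suc m ⊖ suc n ⟧                  ≡⟨ ≡.cong ⟦_⟧ (ℤ.[1+m]⊖[1+n]≡m⊖n m n) ⟩
      ⟦ m ⊖ n ⟧                          ≈⟨ ⊖-homo m n ⟩
      m ×′ 1# - n ×′ 1#                  ≈⟨ [z+x]-[z+y]≈x-y 1# _ _ ⟨
      (1# + m ×′ 1#) - (1# + n ×′ 1#)    ≈⟨ +-cong (×-homo-+ 1# 1 m) (-‿cong (×-homo-+ 1# 1 n)) ⟨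
      suc m ×′ 1# - suc n ×′ 1#          ∎

    +-homo : ∀ i j → ⟦ i ℤ.+ j ⟧ ≈ ⟦ i ⟧ + ⟦ j ⟧
    +-homo (+ m)    (+ n)    = ×-homo-+ 1# m n
    +-homo (+ m)    -[1+ n ] = ⊖-homo m (suc n)
    +-homo -[1+ m ] (+ n)    = trans (⊖-homo n (suc m)) (+-comm _ _)
    +-homo -[1+ m ] -[1+ n ] = begin
      - (suc (suc (m ℕ.+ n)) ×′ 1#)      ≡⟨ ≡.cong (λ k → - (suc k ×′ 1#)) (ℕ.+-suc m n) ⟨
      - ((suc m ℕ.+ suc n) ×′ 1#)        ≈⟨ -‿cong (×-homo-+ 1# (suc m) (suc n)) ⟩
      - (suc m ×′ 1# + suc n ×′ 1#)      ≈⟨ neg-distrib-+ _ _ ⟩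
      - (suc m ×′ 1#) + - (suc n ×′ 1#)  ∎

    -‿homo : ∀ i → ⟦ ℤ.- i ⟧ ≈ - ⟦ i ⟧
    -‿homo (+ zero)  = sym ε⁻¹≈ε
    -‿homo (+ suc n) = refl
    -‿homo -[1+ n ]  = sym (⁻¹-involutive _)

    ⟦_⟧ˢ : Sign → Carrier
    ⟦ Sign.+ ⟧ˢ = 1#
    ⟦ Sign.- ⟧ˢ = - 1#

    ◃-homo : ∀ s n → ⟦ s ◃ n ⟧ ≈ ⟦ s ⟧ˢ * n ×′ 1#
    ◃-homo s       zero    = sym (zeroʳ _)
    ◃-homo Sign.+ (suc n) = sym (*-identityˡ _)
    ◃-homo Sign.- (suc n) = sym (-1*x≈-x _)

    sign-*-homo : ∀ s t → ⟦ s Sign.* t ⟧ˢ ≈ ⟦ s ⟧ˢ * ⟦ t ⟧ˢ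
    sign-*-homo Sign.+ t      = sym (*-identityˡ _)
    sign-*-homo Sign.- Sign.+ = sym (*-identityʳ _)
    sign-*-homo Sign.- Sign.- = sym (trans (-1*x≈-x _) (⁻¹-involutive 1#))

    sign-abs : ∀ i → ⟦ i ⟧ ≈ ⟦ sign i ⟧ˢ * ℤ.∣ i ∣ ×′ 1#
    sign-abs i = trans (reflexive (≡.cong ⟦_⟧ (≡.sym (ℤ.◃-inverse i)))) (◃-homo (sign i) ℤ.∣ i ∣)

    *-homo : ∀ i j → ⟦ i ℤ.* j ⟧ ≈ ⟦ i ⟧ * ⟦ j ⟧
    *-homo i j = begin
      ⟦ sign i Sign.* sign j ◃ ℤ.∣ i ∣ ℕ.* ℤ.∣ j ∣ ⟧
        ≈⟨ ◃-homo (sign i Sign.* sign j) (ℤ.∣ i ∣ ℕ.* ℤ.∣ j ∣) ⟩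
      ⟦ sign i Sign.* sign j ⟧ˢ * (ℤ.∣ i ∣ ℕ.* ℤ.∣ j ∣) ×′ 1#
        ≈⟨ *-cong (sign-*-homo (sign i) (sign j)) (×1-homo-* ℤ.∣ i ∣ ℤ.∣ j ∣) ⟩
      (⟦ sign i ⟧ˢ * ⟦ sign j ⟧ˢ) * (ℤ.∣ i ∣ ×′ 1# * ℤ.∣ j ∣ ×′ 1#)
        ≈⟨ *-interchange _ _ _ _ ⟩
      (⟦ sign i ⟧ˢ * ℤ.∣ i ∣ ×′ 1#) * (⟦ sign j ⟧ˢ * ℤ.∣ j ∣ ×′ 1#)
        ≈⟨ *-cong (sign-abs i) (sign-abs j) ⟨
      ⟦ i ⟧ * ⟦ j ⟧
        ∎

    almostCommutativeRing : AlmostCommutativeRing c ℓ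
    almostCommutativeRing = fromCommutativeRing R

    ℤ⟶R : ℤ.+-*-rawRing -Raw-AlmostCommutative⟶ almostCommutativeRing
    ℤ⟶R = record
      { ⟦_⟧ = ⟦_⟧ ; +-homo = +-homo ; *-homo = *-homo ; -‿homo = -‿homo
      ; 0-homo = refl ; 1-homo = refl }

    _≟⟦⟧_ : ∀ i j → Maybe (⟦ i ⟧ ≈ ⟦ j ⟧)
    i ≟⟦⟧ j with i ℤ.≟ j
    ... | yes ≡.refl = just refl
    ... | no _       = nothing

  open import Algebra.Solver.Ring ℤ.+-*-rawRing almostCommutativeRing ℤ⟶R _≟⟦⟧_ using (con)
  open import Algebra.Solver.Ring ℤ.+-*-rawRing almostCommutativeRing ℤ⟶R _≟⟦⟧_ public
    using (Polynomial; solve; _:+_; _:*_; _:-_; _:=_)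

  :0 :1 : ∀ {n} → Polynomial n
  :0 = con (+ 0)
  :1 = con (+ 1)

∉⇒lookup≡false : ∀ {n} {S : Subset n} {j} → j ∉ S → lookup S j ≡ false
∉⇒lookup≡false {S = S} {j} j∉S with lookup S j in eq
... | true  = ⊥-elim (j∉S (lookup⇒[]= j S eq))
... | false = ≡.refl

x∉p-x : ∀ {n} (p : Subset n) x → x ∉ p ∖ x
x∉p-x (_ ∷ p) Fin.zero    ()
x∉p-x (_ ∷ p) (Fin.suc x) (there x∈p-x) = x∉p-x p x x∈p-x

x∈p-y⇒x≢y : ∀ {n} {p : Subset n} {x y} → x ∈ p ∖ y → x ≢ y
x∈p-y⇒x≢y {p = p} {x} x∈p-x ≡.refl = x∉p-x p x x∈p-x

∖-mono : ∀ {n} {p q : Subset n} {y} → p ⊆ q → p ∖ y ⊆ q ∖ y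
∖-mono p⊆q x∈ = x∈p∧x≢y⇒x∈p-y (p⊆q (p─q⊆p _ _ x∈)) (x∈p-y⇒x≢y x∈)

argmin : ∀ {n p} {P : Pred (Fin n) p} → Decidable P → (f : Fin n → ℕ) → ∃ P →
         ∃ λ w → P w × (∀ {v} → P v → f w ≤ f v)
argmin {P = P} P? f (v , Pv) = go v Pv (<-wellFounded (f v))
  where
  go : ∀ v → P v → Acc _<_ (f v) → ∃ λ w → P w × (∀ {u} → P u → f w ≤ f u)
  go v Pv (acc smaller) with any? (λ u → P? u ×-dec (f u ℕ.<? f v))
  ... | yes (u , Pu , fu<fv) = go u Pu (smaller fu<fv)
  ... | no none              = v , Pv , λ {u} Pu → ℕ.≮⇒≥ (λ fu<fv → none (u , Pu , fu<fv))

module Walks {N : ℕ} (G : Graph N) where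
  open ≡ using (refl; sym; trans)
  open import Data.Nat using (_+_)
  open Graph G

  edge-sym : ∀ {u v} → Edge G u v → Edge G v u
  edge-sym {u} {v} e = trans (adj-sym v u) e

  edge-irrefl : ∀ {u v} → Edge G u v → u ≢ v
  edge-irrefl {u} e refl with trans (sym e) (irrefl u)
  ... | ()

  infix 4 _∈ʷ_ _∉ʷ_
  _∈ʷ_ : ∀ {S x y k} → Fin N → WalkIn G S x y k → Set
  a ∈ʷ here {u} _     = a ≡ u
  a ∈ʷ step {u} _ _ w = a ≡ u ⊎ a ∈ʷ w

  _∉ʷ_ : ∀ {S x y k} → Fin N → WalkIn G S x y k → Set
  a ∉ʷ w = ¬ a ∈ʷ w

  _∈ʷ?_ : ∀ {S x y k} a (w : WalkIn G S x y k) → Dec (a ∈ʷ w)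
  a ∈ʷ? here {u} _     = a Fin.≟ u
  a ∈ʷ? step {u} _ _ w with a Fin.≟ u | a ∈ʷ? w
  ... | yes a≡u | _       = yes (inj₁ a≡u)
  ... | no _    | yes a∈w = yes (inj₂ a∈w)
  ... | no a≢u  | no a∉w  = no λ { (inj₁ a≡u) → a≢u a≡u ; (inj₂ a∈w) → a∉w a∈w }

  start∈ʷ : ∀ {S x y k} (w : WalkIn G S x y k) → x ∈ʷ w
  start∈ʷ (here _)     = refl
  start∈ʷ (step _ _ _) = inj₁ refl

  end∈ʷ : ∀ {S x y k} (w : WalkIn G S x y k) → y ∈ʷ w
  end∈ʷ (here _)     = refl
  end∈ʷ (step _ _ w) = inj₂ (end∈ʷ w)

  ∈ʷ⇒∈ : ∀ {S x y k a} (w : WalkIn G S x y k) → a ∈ʷ w → a ∈ S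
  ∈ʷ⇒∈ (here s)     refl        = s
  ∈ʷ⇒∈ (step s _ _) (inj₁ refl) = s
  ∈ʷ⇒∈ (step _ _ w) (inj₂ a∈w)  = ∈ʷ⇒∈ w a∈w

  infixr 5 _++_
  _++_ : ∀ {S x y z k l} → WalkIn G S x y k → WalkIn G S y z l → WalkIn G S x z (k + l)
  here _     ++ w′ = w′
  step s e w ++ w′ = step s e (w ++ w′)

  ∈ʷ-++⁻ : ∀ {S x y z k l a} (w : WalkIn G S x y k) {w′ : WalkIn G S y z l} →
           a ∈ʷ w ++ w′ → a ∈ʷ w ⊎ a ∈ʷ w′
  ∈ʷ-++⁻ (here _)     a∈w′        = inj₂ a∈w′
  ∈ʷ-++⁻ (step _ _ w) (inj₁ a≡u)  = inj₁ (inj₁ a≡u)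
  ∈ʷ-++⁻ (step _ _ w) (inj₂ a∈ww′) with ∈ʷ-++⁻ w a∈ww′
  ... | inj₁ a∈w  = inj₁ (inj₂ a∈w)
  ... | inj₂ a∈w′ = inj₂ a∈w′

  private
    cast : ∀ {S x y k l} → k ≡ l → WalkIn G S x y k → WalkIn G S x y l
    cast refl w = w

    ∈ʷ-cast⁻ : ∀ {S x y k l a} (k≡l : k ≡ l) (w : WalkIn G S x y k) → a ∈ʷ cast k≡l w → a ∈ʷ w
    ∈ʷ-cast⁻ refl w a∈w = a∈w

  reverse : ∀ {S x y k} → WalkIn G S x y k → WalkIn G S y x k
  reverse (here s)             = here s
  reverse (step {k = k} s e w) =
    cast (ℕ.+-comm k 1) (reverse w ++ step (∈ʷ⇒∈ w (start∈ʷ w)) (edge-sym e) (here s))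

  ∈ʷ-reverse⁻ : ∀ {S x y k a} (w : WalkIn G S x y k) → a ∈ʷ reverse w → a ∈ʷ w
  ∈ʷ-reverse⁻ (here _)             a∈w = a∈w
  ∈ʷ-reverse⁻ (step {k = k} _ _ w) a∈w with ∈ʷ-++⁻ (reverse w) (∈ʷ-cast⁻ (ℕ.+-comm k 1) _ a∈w)
  ... | inj₁ a∈rw              = inj₂ (∈ʷ-reverse⁻ w a∈rw)
  ... | inj₂ (inj₁ refl)       = inj₂ (start∈ʷ w)
  ... | inj₂ (inj₂ a≡x)        = inj₁ a≡x

  restrict : ∀ {S S′ x y k} (w : WalkIn G S x y k) → (∀ {a} → a ∈ʷ w → a ∈ S′) → WalkIn G S′ x y k
  restrict (here _)     inS′ = here (inS′ refl)
  restrict (step _ e w) inS′ = step (inS′ (inj₁ refl)) e (restrict w (inS′ ∘ inj₂))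

  weaken : ∀ {S S′ x y k} → S ⊆ S′ → WalkIn G S x y k → WalkIn G S′ x y k
  weaken S⊆S′ w = restrict w (S⊆S′ ∘ ∈ʷ⇒∈ w)

  reverse-restrict : ∀ {S S′ x y k} (w : WalkIn G S x y k) → (∀ {a} → a ∈ʷ w → a ∈ S′) → WalkIn G S′ y x k
  reverse-restrict w inS′ = restrict (reverse w) (inS′ ∘ ∈ʷ-reverse⁻ w)

  Simple : ∀ {S x y k} → WalkIn G S x y k → Set
  Simple (here _)         = Unit
  Simple (step {u} _ _ w) = u ∉ʷ w × Simple w

  record Split {S x y k} (w : WalkIn G S x y k) (a : Fin N) : Set where
    field
      {k₁ k₂}       : ℕ
      prefix        : WalkIn G S x a k₁
      suffix        : WalkIn G S a y k₂
      length        : k₁ + k₂ ≡ k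
      prefix⊆       : ∀ {b} → b ∈ʷ prefix → b ∈ʷ w
      suffix⊆       : ∀ {b} → b ∈ʷ suffix → b ∈ʷ w
      suffix-simple : Simple w → Simple suffix
      meet-only-at  : Simple w → ∀ {b} → b ∈ʷ prefix → b ∈ʷ suffix → b ≡ a

  split : ∀ {S x y k a} (w : WalkIn G S x y k) → a ∈ʷ w → Split w a
  split (here s) refl = record
    { prefix = here s ; suffix = here s ; length = refl
    ; prefix⊆ = λ b∈ → b∈ ; suffix⊆ = λ b∈ → b∈
    ; suffix-simple = λ _ → tt ; meet-only-at = λ _ b≡a _ → b≡a }
  split (step s e w) (inj₁ refl) = record
    { prefix = here s ; suffix = step s e w ; length = refl
    ; prefix⊆ = inj₁ ; suffix⊆ = λ b∈ → b∈
    ; suffix-simple = λ simple → simple ; meet-only-at = λ _ b≡a _ → b≡a }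
  split (step s e w) (inj₂ a∈w) = record
    { prefix = step s e prefix ; suffix = suffix ; length = ≡.cong suc length
    ; prefix⊆ = λ { (inj₁ b≡u) → inj₁ b≡u ; (inj₂ b∈) → inj₂ (prefix⊆ b∈) }
    ; suffix⊆ = inj₂ ∘ suffix⊆
    ; suffix-simple = suffix-simple ∘ proj₂
    ; meet-only-at = λ { (u∉w , simple) (inj₁ refl) b∈s → ⊥-elim (u∉w (suffix⊆ b∈s))
                       ; (_ , simple) (inj₂ b∈p) b∈s → meet-only-at simple b∈p b∈s } }
    where open Split (split w a∈w)

  record Simplification {S x y k} (w : WalkIn G S x y k) : Set where
    field
      {length} : ℕ
      path     : WalkIn G S x y length
      simple   : Simple path
      path⊆    : ∀ {b} → b ∈ʷ path → b ∈ʷ w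

  simplify : ∀ {S x y k} (w : WalkIn G S x y k) → Simplification w
  simplify (here s) = record { path = here s ; simple = tt ; path⊆ = λ b∈ → b∈ }
  simplify (step {u} s e w) with simplify w
  ... | record { path = p ; simple = simple ; path⊆ = path⊆ } with u ∈ʷ? p
  ...   | yes u∈p = record { path = suffix ; simple = suffix-simple simple ; path⊆ = inj₂ ∘ path⊆ ∘ suffix⊆ }
    where open Split (split p u∈p)
  ...   | no u∉p  = record { path = step s e p ; simple = u∉p , simple
                           ; path⊆ = λ { (inj₁ b≡u) → inj₁ b≡u ; (inj₂ b∈p) → inj₂ (path⊆ b∈p) } }

  connected-via : ∀ {C S} → C ⊆ S → ConnectedIn G C →
                  (∀ {u} → u ∈ S → ∃₂ λ c k → c ∈ C × WalkIn G S u c k) → ConnectedIn G S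
  connected-via C⊆S C-connected reach u v u∈S v∈S
    with reach u∈S | reach v∈S
  ... | c , _ , c∈C , u⇝c | c′ , _ , c′∈C , v⇝c′
    with C-connected c c′ c∈C c′∈C
  ...   | _ , c⇝c′ = _ , u⇝c ++ weaken C⊆S c⇝c′ ++ reverse v⇝c′

module Blocks {N : ℕ} (G : Graph N) where
  open ≡ using (refl; sym; trans; subst)
  open Walks G

  vertexSet : ∀ {S x y k} → WalkIn G S x y k → Subset N
  vertexSet w = tabulate (λ a → does (a ∈ʷ? w))

  ∈ʷ⇒∈vertexSet : ∀ {S x y k a} (w : WalkIn G S x y k) → a ∈ʷ w → a ∈ vertexSet w
  ∈ʷ⇒∈vertexSet {a = a} w a∈w = lookup⇒[]= a _ (trans (lookup∘tabulate _ a) (dec-true (a ∈ʷ? w) a∈w))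

  ∈vertexSet⇒∈ʷ : ∀ {S x y k a} (w : WalkIn G S x y k) → a ∈ vertexSet w → a ∈ʷ w
  ∈vertexSet⇒∈ʷ {a = a} w a∈V
    with a ∈ʷ? w | trans (sym (lookup∘tabulate (λ b → does (b ∈ʷ? w)) a)) ([]=⇒lookup a∈V)
  ... | yes a∈w | _ = a∈w
  ... | no _    | ()

  minus-connected : ∀ {B} → ConnectedIn G B → NoCutVertex G B → ∀ v → ConnectedIn G (B ∖ v)
  minus-connected {B} B-connected B-noCut v x y x∈ y∈ with v ∈? B
  ... | yes v∈B = B-noCut v v∈B x y x∈ y∈
  ... | no v∉B with B-connected x y (p─q⊆p _ _ x∈) (p─q⊆p _ _ y∈)
  ...   | k , w = k , restrict w λ a∈w →
          x∈p∧x≢y⇒x∈p-y (∈ʷ⇒∈ w a∈w) λ { refl → v∉B (∈ʷ⇒∈ w a∈w) }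

  module Ear {B} (B-connected : ConnectedIn G B) (B-noCut : NoCutVertex G B)
             {a b k} (P : WalkIn G ⊤ a b k) (P-simple : Simple P) (a∈B : a ∈ B) (b∈B : b ∈ B) where

    T : Subset N
    T = B ∪ vertexSet P

    B⊆T : B ⊆ T
    B⊆T = x∈p∪q⁺ ∘ inj₁

    P⊆T : ∀ {u} → u ∈ʷ P → u ∈ T
    P⊆T = x∈p∪q⁺ ∘ inj₂ ∘ ∈ʷ⇒∈vertexSet P

    T-connected : ConnectedIn G T
    T-connected = connected-via B⊆T B-connected reach
      where
      reach : ∀ {u} → u ∈ T → ∃₂ λ c l → c ∈ B × WalkIn G T u c l
      reach {u} u∈T with x∈p∪q⁻ B (vertexSet P) u∈T
      ... | inj₁ u∈B = u , 0 , u∈B , here u∈T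
      ... | inj₂ u∈V = a , _ , a∈B , reverse-restrict prefix (P⊆T ∘ prefix⊆)
        where open Split (split P (∈vertexSet⇒∈ʷ P u∈V))

    -- The prefix and the suffix of the simple path P at u meet only in u, so one of them avoids v.
    along-P-avoiding : ∀ {u} v → u ∈ʷ P → u ≢ v → ∃₂ λ c l → c ∈ B ∖ v × WalkIn G (T ∖ v) u c l
    along-P-avoiding v u∈P u≢v = go (v ∈ʷ? prefix)
      where
      open Split (split P u∈P)
      go : Dec (v ∈ʷ prefix) → ∃₂ λ c l → c ∈ B ∖ v × WalkIn G (T ∖ v) _ c l
      go (no v∉prefix) = a , _ , x∈p∧x≢y⇒x∈p-y a∈B (avoids (start∈ʷ prefix)) ,
                         reverse-restrict prefix (λ c∈ → x∈p∧x≢y⇒x∈p-y (P⊆T (prefix⊆ c∈)) (avoids c∈))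
        where
        avoids : ∀ {c} → c ∈ʷ prefix → c ≢ v
        avoids c∈ refl = v∉prefix c∈
      go (yes v∈prefix) = b , _ , x∈p∧x≢y⇒x∈p-y b∈B (avoids (end∈ʷ suffix)) ,
                          restrict suffix (λ c∈ → x∈p∧x≢y⇒x∈p-y (P⊆T (suffix⊆ c∈)) (avoids c∈))
        where
        avoids : ∀ {c} → c ∈ʷ suffix → c ≢ v
        avoids c∈ refl = u≢v (sym (meet-only-at P-simple v∈prefix c∈))

    reach-B-avoiding : ∀ {u} v → u ∈ T → u ≢ v → ∃₂ λ c l → c ∈ B ∖ v × WalkIn G (T ∖ v) u c l
    reach-B-avoiding {u} v u∈T u≢v with x∈p∪q⁻ B (vertexSet P) u∈T
    ... | inj₁ u∈B = u , 0 , x∈p∧x≢y⇒x∈p-y u∈B u≢v , here (x∈p∧x≢y⇒x∈p-y u∈T u≢v)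
    ... | inj₂ u∈V = along-P-avoiding v (∈vertexSet⇒∈ʷ P u∈V) u≢v

    T-noCut : NoCutVertex G T
    T-noCut v _ = connected-via (∖-mono B⊆T) (minus-connected B-connected B-noCut v)
                    (λ u∈ → reach-B-avoiding v (p─q⊆p _ _ u∈) (x∈p-y⇒x≢y u∈))

  reentry-visits-exit : ∀ {B a c z k} → IsBlock G B → a ∈ B → c ∉ B → Edge G a c →
                        (w : WalkIn G ⊤ c z k) → z ∈ B → a ∈ʷ w
  reentry-visits-exit {B} {a} {c} (_ , B-connected , B-noCut , maximal) a∈B c∉B e w z∈B with a ∈ʷ? w
  ... | yes a∈w = a∈w
  ... | no a∉w  = ⊥-elim (c∉B (subst (c ∈_) (maximal T B⊆T T-connected T-noCut) (P⊆T (inj₂ (start∈ʷ path)))))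
    where
    open Simplification (simplify w)
    open Ear B-connected B-noCut (step ∈⊤ e path) ((a∉w ∘ path⊆) , simple) a∈B z∈B

  ∪-connected : ∀ {S C₁ C₂ h} → C₁ ⊆ S → C₂ ⊆ S → (∀ {u} → u ∈ S → u ∈ C₁ ⊎ u ∈ C₂) →
                ConnectedIn G C₁ → ConnectedIn G C₂ → h ∈ C₁ → h ∈ C₂ → ConnectedIn G S
  ∪-connected {S} {C₁} {C₂} {h} C₁⊆S C₂⊆S cover C₁-connected C₂-connected h∈C₁ h∈C₂ =
    connected-via C₁⊆S C₁-connected reach
    where
    reach : ∀ {u} → u ∈ S → ∃₂ λ c l → c ∈ C₁ × WalkIn G S u c l
    reach {u} u∈S with cover u∈S
    ... | inj₁ u∈C₁ = u , 0 , u∈C₁ , here u∈S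
    ... | inj₂ u∈C₂ = h , _ , h∈C₁ , weaken C₂⊆S (proj₂ (C₂-connected u h u∈C₂ h∈C₂))

  blocks-sharing-two-vertices-coincide : ∀ {S₁ S₂ u v} → IsBlock G S₁ → IsBlock G S₂ → u ≢ v →
                                         u ∈ S₁ → v ∈ S₁ → u ∈ S₂ → v ∈ S₂ → S₁ ≡ S₂
  blocks-sharing-two-vertices-coincide {S₁} {S₂} {u} {v}
    (_ , S₁-connected , S₁-noCut , S₁-maximal) (_ , S₂-connected , S₂-noCut , S₂-maximal)
    u≢v u∈S₁ v∈S₁ u∈S₂ v∈S₂ =
    trans (sym (S₁-maximal T (x∈p∪q⁺ ∘ inj₁) T-connected T-noCut))
          (S₂-maximal T (x∈p∪q⁺ ∘ inj₂) T-connected T-noCut)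
    where
    T = S₁ ∪ S₂

    T-connected : ConnectedIn G T
    T-connected = ∪-connected (x∈p∪q⁺ ∘ inj₁) (x∈p∪q⁺ ∘ inj₂) (x∈p∪q⁻ S₁ S₂)
                    S₁-connected S₂-connected u∈S₁ u∈S₂

    T-minus-connected : ∀ {h z} → h ≢ z → h ∈ S₁ → h ∈ S₂ → ConnectedIn G (T ∖ z)
    T-minus-connected {z = z} h≢z h∈S₁ h∈S₂ =
      ∪-connected (∖-mono (x∈p∪q⁺ ∘ inj₁)) (∖-mono (x∈p∪q⁺ ∘ inj₂)) cover
        (minus-connected S₁-connected S₁-noCut z) (minus-connected S₂-connected S₂-noCut z)
        (x∈p∧x≢y⇒x∈p-y h∈S₁ h≢z) (x∈p∧x≢y⇒x∈p-y h∈S₂ h≢z)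
      where
      cover : ∀ {x} → x ∈ T ∖ z → x ∈ S₁ ∖ z ⊎ x ∈ S₂ ∖ z
      cover x∈ with x∈p∪q⁻ S₁ S₂ (p─q⊆p _ _ x∈)
      ... | inj₁ x∈S₁ = inj₁ (x∈p∧x≢y⇒x∈p-y x∈S₁ (x∈p-y⇒x≢y x∈))
      ... | inj₂ x∈S₂ = inj₂ (x∈p∧x≢y⇒x∈p-y x∈S₂ (x∈p-y⇒x≢y x∈))

    T-noCut : NoCutVertex G T
    T-noCut z _ with u Fin.≟ z
    ... | no u≢z   = T-minus-connected u≢z u∈S₁ u∈S₂
    ... | yes refl = T-minus-connected (u≢v ∘ sym) v∈S₁ v∈S₂

  -- Doubly negated because it cannot be decided whether S is already maximal.
  ¬¬-contained-in-block : ∀ {S} → Nonempty S → ConnectedIn G S → NoCutVertex G S →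
                          ¬ ¬ (∃ λ B → IsBlock G B × S ⊆ B)
  ¬¬-contained-in-block = go (⊃-wellFounded _)
    where
    go : ∀ {S} → Acc _⊃_ S → Nonempty S → ConnectedIn G S → NoCutVertex G S →
         ¬ ¬ (∃ λ B → IsBlock G B × S ⊆ B)
    go {S} (acc larger) (x , x∈S) S-connected S-noCut no-block =
      no-block (S , ((x , x∈S) , S-connected , S-noCut , maximal) , λ x∈ → x∈)
      where
      maximal : ∀ T → S ⊆ T → ConnectedIn G T → NoCutVertex G T → T ≡ S
      maximal T S⊆T T-connected T-noCut with any? (λ y → (y ∈? T) ×-dec ¬? (y ∈? S))
      ... | no  T⊈S = ⊆-antisym (λ {y} y∈T → decidable-stable (y ∈? S) (λ y∉S → T⊈S (y , y∈T , y∉S))) S⊆T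
      ... | yes (y , y∈T , y∉S) = ⊥-elim
              (go (larger (S⊆T , y , y∈T , y∉S)) (x , S⊆T x∈S) T-connected T-noCut
                  (λ { (B , B-block , T⊆B) → no-block (B , B-block , T⊆B ∘ S⊆T) }))

  subsingleton-connected : ∀ {S} → (∀ {x y} → x ∈ S → y ∈ S → x ≡ y) → ConnectedIn G S
  subsingleton-connected all-equal x y x∈S y∈S with all-equal x∈S y∈S
  ... | refl = 0 , here x∈S

  ¬¬-edge-in-block : ∀ {u v} → Edge G u v → ¬ ¬ (∃ λ B → IsBlock G B × u ∈ B × v ∈ B)
  ¬¬-edge-in-block {u} {v} e no-block =
    ¬¬-contained-in-block (u , u∈S) S-connected S-noCut
      (λ { (B , B-block , S⊆B) → no-block (B , B-block , S⊆B u∈S , S⊆B v∈S) })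
    where
    S = ⁅ u ⁆ ∪ ⁅ v ⁆
    u∈S = x∈p∪q⁺ (inj₁ (x∈⁅x⁆ u))
    v∈S = x∈p∪q⁺ (inj₂ (x∈⁅x⁆ v))

    endpoint : ∀ {x} → x ∈ S → x ≡ u ⊎ x ≡ v
    endpoint x∈S with x∈p∪q⁻ ⁅ u ⁆ ⁅ v ⁆ x∈S
    ... | inj₁ x∈u = inj₁ (x∈⁅y⁆⇒x≡y u x∈u)
    ... | inj₂ x∈v = inj₂ (x∈⁅y⁆⇒x≡y v x∈v)

    S-connected : ConnectedIn G S
    S-connected = connected-via (λ x∈u → x∈p∪q⁺ (inj₁ x∈u))
                    (subsingleton-connected (λ x∈u y∈u → trans (x∈⁅y⁆⇒x≡y u x∈u) (sym (x∈⁅y⁆⇒x≡y u y∈u))))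
                    reach
      where
      reach : ∀ {x} → x ∈ S → ∃₂ λ c k → c ∈ ⁅ u ⁆ × WalkIn G S x c k
      reach x∈S with endpoint x∈S
      ... | inj₁ refl = u , 0 , x∈⁅x⁆ u , here u∈S
      ... | inj₂ refl = u , 1 , x∈⁅x⁆ u , step v∈S (edge-sym e) (here u∈S)

    one-left : ∀ {x y z} → x ≡ u ⊎ x ≡ v → y ≡ u ⊎ y ≡ v → z ≡ u ⊎ z ≡ v → x ≢ z → y ≢ z → x ≡ y
    one-left (inj₁ refl) (inj₁ refl) _           _   _   = refl
    one-left (inj₂ refl) (inj₂ refl) _           _   _   = refl
    one-left (inj₁ refl) (inj₂ refl) (inj₁ refl) x≢z _   = ⊥-elim (x≢z refl)
    one-left (inj₁ refl) (inj₂ refl) (inj₂ refl) _   y≢z = ⊥-elim (y≢z refl)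
    one-left (inj₂ refl) (inj₁ refl) (inj₁ refl) _   y≢z = ⊥-elim (y≢z refl)
    one-left (inj₂ refl) (inj₁ refl) (inj₂ refl) x≢z _   = ⊥-elim (x≢z refl)

    S-noCut : NoCutVertex G S
    S-noCut z z∈S = subsingleton-connected λ x∈ y∈ →
      one-left (endpoint (p─q⊆p _ _ x∈)) (endpoint (p─q⊆p _ _ y∈)) (endpoint z∈S)
               (x∈p-y⇒x≢y x∈) (x∈p-y⇒x≢y y∈)

module Distances {N : ℕ} (G : Graph N)
                 (d : Fin N → Fin N → ℕ) (d-isDistance : ∀ u v → IsDistance G u v (d u v)) where
  open ≡ using (refl; sym; subst)
  open import Data.Nat using (_+_)
  open Walks G

  geodesic : ∀ u v → WalkIn G ⊤ u v (d u v)
  geodesic u v = proj₁ (d-isDistance u v)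

  d-minimal : ∀ {S u v k} → WalkIn G S u v k → d u v ≤ k
  d-minimal w = proj₂ (d-isDistance _ _) _ (weaken ⊆⊤ w)

  d-refl : ∀ u → d u u ≡ 0
  d-refl u = ℕ.n≤0⇒n≡0 (d-minimal (here {u = u} ∈⊤))

  d≡0⇒≡ : ∀ {u v} → d u v ≡ 0 → u ≡ v
  d≡0⇒≡ {u} {v} = go (geodesic u v)
    where
    go : ∀ {k} → WalkIn G ⊤ u v k → k ≡ 0 → u ≡ v
    go (here _) _ = refl

  d-sym : ∀ u v → d u v ≡ d v u
  d-sym u v = ℕ.≤-antisym (d-minimal (reverse (geodesic v u))) (d-minimal (reverse (geodesic u v)))

  d≡1⇒edge : ∀ {u v} → d u v ≡ 1 → Edge G u v
  d≡1⇒edge {u} {v} = go (geodesic u v)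
    where
    go : ∀ {k} → WalkIn G ⊤ u v k → k ≡ 1 → Edge G u v
    go (step _ e (here _)) _ = e

  d-via : ∀ {S u v k a} (w : WalkIn G S u v k) → a ∈ʷ w → d u a + d a v ≤ k
  d-via w a∈w = subst (_ ≤_) length (ℕ.+-mono-≤ (d-minimal prefix) (d-minimal suffix))
    where open Split (split w a∈w)

  d-on-geodesic : ∀ {u v a} → a ∈ʷ geodesic u v → d u a + d a v ≡ d u v
  d-on-geodesic {u} {v} {a} a∈ =
    ℕ.≤-antisym (d-via (geodesic u v) a∈) (d-minimal (geodesic u a ++ geodesic a v))

  on-geodesic⇒≤ : ∀ {u v a} → a ∈ʷ geodesic u v → d u a ≤ d u v
  on-geodesic⇒≤ {u} {v} {a} a∈ = subst (d u a ≤_) (d-on-geodesic a∈) (ℕ.m≤m+n (d u a) (d a v))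

  record Descent (u v : Fin N) : Set where
    field
      {next} {steps} : _
      edge           : Edge G u next
      rest           : WalkIn G ⊤ next v steps
      length         : suc steps ≡ d u v

    next-closer : d next v < d u v
    next-closer = subst (d next v <_) length (s≤s (d-minimal rest))

    start∉rest : u ∉ʷ rest
    start∉rest u∈rest = ℕ.<-irrefl (sym length) (s≤s (ℕ.m+n≤o⇒n≤o (d next u) (d-via rest u∈rest)))

  descent : ∀ {u v} → u ≢ v → Descent u v
  descent {u} {v} u≢v = go (geodesic u v) refl
    where
    go : ∀ {k} → WalkIn G ⊤ u v k → k ≡ d u v → Descent u v
    go (here _)        _      = ⊥-elim (u≢v refl)
    go (step _ e rest) length = record { edge = e ; rest = rest ; length = length }

module BiBlockGeometry {N r : ℕ} (G : Graph N) (X Y : Fin r → Subset N) (biBlock : IsBiBlock G r X Y)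
                       (d : Fin N → Fin N → ℕ) (d-isDistance : ∀ u v → IsDistance G u v (d u v)) where
  open ≡ using (refl; sym; subst; subst₂)
  open import Data.Nat using (_+_)
  open IsBiBlock biBlock
  open Walks G
  open Blocks G
  open Distances G d d-isDistance

  B : Fin r → Subset N
  B k = X k ∪ Y k

  X⊆B : ∀ {k} → X k ⊆ B k
  X⊆B = x∈p∪q⁺ ∘ inj₁

  Y⊆B : ∀ {k} → Y k ⊆ B k
  Y⊆B = x∈p∪q⁺ ∘ inj₂

  X∩Y-empty : ∀ {k u} → u ∈ X k → u ∉ Y k
  X∩Y-empty {k} {u} u∈X u∈Y = ∉⊥ (subst (u ∈_) (disjoint k) (x∈p∩q⁺ (u∈X , u∈Y)))

  Opposite SameSide : Fin r → Fin N → Fin N → Set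
  Opposite k u v = (u ∈ X k × v ∈ Y k) ⊎ (u ∈ Y k × v ∈ X k)
  SameSide k u v = (u ∈ X k × v ∈ X k) ⊎ (u ∈ Y k × v ∈ Y k)

  opposite-or-same-side : ∀ {k u v} → u ∈ B k → v ∈ B k → Opposite k u v ⊎ SameSide k u v
  opposite-or-same-side {k} {u} {v} u∈B v∈B with x∈p∪q⁻ (X k) (Y k) u∈B | x∈p∪q⁻ (X k) (Y k) v∈B
  ... | inj₁ u∈X | inj₁ v∈X = inj₂ (inj₁ (u∈X , v∈X))
  ... | inj₁ u∈X | inj₂ v∈Y = inj₁ (inj₁ (u∈X , v∈Y))
  ... | inj₂ u∈Y | inj₁ v∈X = inj₁ (inj₂ (u∈Y , v∈X))
  ... | inj₂ u∈Y | inj₂ v∈Y = inj₂ (inj₂ (u∈Y , v∈Y))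

  opposite-sym : ∀ {k u v} → Opposite k u v → Opposite k v u
  opposite-sym (inj₁ (u∈X , v∈Y)) = inj₂ (v∈Y , u∈X)
  opposite-sym (inj₂ (u∈Y , v∈X)) = inj₁ (v∈X , u∈Y)

  opposite⇒≢ : ∀ {k u v} → Opposite k u v → u ≢ v
  opposite⇒≢ (inj₁ (u∈X , v∈Y)) refl = X∩Y-empty u∈X v∈Y
  opposite⇒≢ (inj₂ (u∈Y , v∈X)) refl = X∩Y-empty v∈X u∈Y

  same-side⇒¬opposite : ∀ {k u v} → SameSide k u v → ¬ Opposite k u v
  same-side⇒¬opposite (inj₁ (u∈X , _))   (inj₂ (u∈Y , _)) = X∩Y-empty u∈X u∈Y
  same-side⇒¬opposite (inj₁ (_ , v∈X))   (inj₁ (_ , v∈Y)) = X∩Y-empty v∈X v∈Y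
  same-side⇒¬opposite (inj₂ (u∈Y , _))   (inj₁ (u∈X , _)) = X∩Y-empty u∈X u∈Y
  same-side⇒¬opposite (inj₂ (_ , v∈Y))   (inj₂ (_ , v∈X)) = X∩Y-empty v∈X v∈Y

  opposite⇒∈B : ∀ {k u v} → Opposite k u v → u ∈ B k × v ∈ B k
  opposite⇒∈B (inj₁ (u∈X , v∈Y)) = X⊆B u∈X , Y⊆B v∈Y
  opposite⇒∈B (inj₂ (u∈Y , v∈X)) = Y⊆B u∈Y , X⊆B v∈X

  opposite⇒edge : ∀ {k u v} → Opposite k u v → Edge G u v
  opposite⇒edge {k} {u} {v} opp =
    Equivalence.from (bipartite k u v (proj₁ (opposite⇒∈B opp)) (proj₂ (opposite⇒∈B opp))) opp

  via-other-side : ∀ {k u v} → SameSide k u v → ∃ λ x → Opposite k u x × Opposite k x v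
  via-other-side {k} (inj₁ (u∈X , v∈X)) =
    let x , x∈Y = Y-nonempty k in x , inj₁ (u∈X , x∈Y) , inj₂ (x∈Y , v∈X)
  via-other-side {k} (inj₂ (u∈Y , v∈Y)) =
    let x , x∈X = X-nonempty k in x , inj₂ (u∈Y , x∈X) , inj₁ (x∈X , v∈Y)

  d-opposite : ∀ {k u v} → Opposite k u v → d u v ≡ 1
  d-opposite opp = ℕ.≤-antisym (d-minimal (step ∈⊤ (opposite⇒edge opp) (here ∈⊤)))
                               (ℕ.n≢0⇒n>0 (opposite⇒≢ opp ∘ d≡0⇒≡))

  same-side⇒∈B : ∀ {k u v} → SameSide k u v → u ∈ B k × v ∈ B k
  same-side⇒∈B (inj₁ (u∈X , v∈X)) = X⊆B u∈X , X⊆B v∈X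
  same-side⇒∈B (inj₂ (u∈Y , v∈Y)) = Y⊆B u∈Y , Y⊆B v∈Y

  same-side⇒¬edge : ∀ {k u v} → SameSide k u v → ¬ Edge G u v
  same-side⇒¬edge {k} {u} {v} same e =
    same-side⇒¬opposite same (Equivalence.to (bipartite k u v (proj₁ ∈B) (proj₂ ∈B)) e)
    where ∈B = same-side⇒∈B same

  d-same-side : ∀ {k u v} → SameSide k u v → u ≢ v → d u v ≡ 2
  d-same-side {k} {u} {v} same u≢v = ℕ.≤-antisym d≤2 (ℕ.≤∧≢⇒< (ℕ.n≢0⇒n>0 (u≢v ∘ d≡0⇒≡)) 1≢d)
    where
    d≤2 : d u v ≤ 2
    d≤2 with via-other-side same
    ... | _ , ux , xv = d-minimal (step ∈⊤ (opposite⇒edge ux) (step ∈⊤ (opposite⇒edge xv) (here ∈⊤)))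
    1≢d : 1 ≢ d u v
    1≢d 1≡d = same-side⇒¬edge same (d≡1⇒edge (sym 1≡d))

  closer-neighbour : ∀ {k w j} → w ∈ B k → j ∈ B k → j ≢ w →
                     ∃ λ y → y ∈ B k × Edge G j y × d w y < d w j
  closer-neighbour {k} {w} {j} w∈B j∈B j≢w with opposite-or-same-side w∈B j∈B
  ... | inj₁ opp = w , w∈B , opposite⇒edge (opposite-sym opp) ,
                   subst₂ _<_ (sym (d-refl w)) (sym (d-opposite opp)) (s≤s z≤n)
  ... | inj₂ same with via-other-side same
  ...   | y , wy , yj = y , proj₂ (opposite⇒∈B wy) , opposite⇒edge (opposite-sym yj) ,
                        subst₂ _<_ (sym (d-opposite wy)) (sym (d-same-side same (j≢w ∘ sym))) (s≤s (s≤s z≤n))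

  edge-in-block : ∀ {u v} → Edge G u v → ∃ λ k → u ∈ B k × v ∈ B k
  edge-in-block {u} {v} e = decidable-stable (any? λ k → (u ∈? B k) ×-dec (v ∈? B k)) λ none →
    ¬¬-edge-in-block e λ { (S , S-block , u∈S , v∈S) →
      let k , S≡B = all-blocks S S-block in none (k , subst (u ∈_) S≡B u∈S , subst (v ∈_) S≡B v∈S) }

  same-block : ∀ {k l u v} → u ≢ v → u ∈ B k → v ∈ B k → u ∈ B l → v ∈ B l → k ≡ l
  same-block {k} {l} u≢v u∈k v∈k u∈l v∈l =
    distinct k l (blocks-sharing-two-vertices-coincide (is-block k) (is-block l) u≢v u∈k v∈k u∈l v∈l)

  module Gates (i : Fin N) where

    private
      nearest : ∀ k → ∃ λ w → w ∈ B k × (∀ {v} → v ∈ B k → d i w ≤ d i v)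
      nearest k = argmin (_∈? B k) (d i) (let x , x∈X = X-nonempty k in x , X⊆B x∈X)

    gate : Fin r → Fin N
    gate k = proj₁ (nearest k)

    gate∈B : ∀ k → gate k ∈ B k
    gate∈B k = proj₁ (proj₂ (nearest k))

    gate-nearest : ∀ {k v} → v ∈ B k → d i (gate k) ≤ d i v
    gate-nearest {k} = proj₂ (proj₂ (nearest k))

    d-via-gate : ∀ {k j} → j ∈ B k → d i j ≡ d i (gate k) + d (gate k) j
    d-via-gate {k} {j} j∈B with gate k ∈ʷ? geodesic i j
    ... | yes w∈geo = sym (d-on-geodesic w∈geo)
    ... | no  w∉geo =
      ⊥-elim (w∉walk (reentry-visits-exit (is-block k) (gate∈B k) next∉B edge (rest ++ geodesic i j) j∈B))
      where
      w = gate k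
      w≢i : w ≢ i
      w≢i w≡i = w∉geo (subst (_∈ʷ geodesic i j) (sym w≡i) (start∈ʷ (geodesic i j)))
      open Descent (descent w≢i)
      next∉B : next ∉ B k
      next∉B next∈B = ℕ.≤⇒≯ (gate-nearest next∈B) (subst₂ _<_ (d-sym next i) (d-sym w i) next-closer)
      w∉walk : w ∉ʷ rest ++ geodesic i j
      w∉walk w∈ with ∈ʷ-++⁻ rest w∈
      ... | inj₁ w∈rest = start∉rest w∈rest
      ... | inj₂ w∈geo′ = w∉geo w∈geo′

    non-gate-block : ∀ {j} → j ≢ i → ∃ λ k → j ∈ B k × j ≢ gate k
    non-gate-block {j} j≢i with descent j≢i
    ... | D with edge-in-block (Descent.edge D)
    ...   | k , j∈B , next∈B = k , j∈B , λ { refl → ℕ.≤⇒≯ (gate-nearest next∈B) closer }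
      where
      open Descent D
      closer : d i next < d i j
      closer = subst₂ _<_ (d-sym next i) (d-sym j i) next-closer

    non-gate-block-unique : ∀ {j k l} → j ∈ B k → j ≢ gate k → j ∈ B l → j ≢ gate l → k ≡ l
    non-gate-block-unique {j} {k} {l} j∈k j≢wk j∈l j≢wl with k Fin.≟ l
    ... | yes k≡l = k≡l
    ... | no  k≢l with closer-neighbour (gate∈B k) j∈k j≢wk
    ...   | y , y∈k , e , y-closer =
              ⊥-elim (j∉walk (reentry-visits-exit (is-block l) j∈l y∉l e walk (gate∈B l)))
      where
      y∉l : y ∉ B l
      y∉l y∈l = k≢l (same-block (edge-irrefl e) j∈k y∈k j∈l y∈l)
      i-closer : d i y < d i j
      i-closer = subst₂ _<_ (sym (d-via-gate y∈k)) (sym (d-via-gate j∈k))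
                   (ℕ.+-monoʳ-< (d i (gate k)) y-closer)
      gate-closer : d i (gate l) < d i j
      gate-closer = subst (d i (gate l) <_) (sym (d-via-gate j∈l))
                      (ℕ.m<m+n (d i (gate l)) (ℕ.n≢0⇒n>0 (j≢wl ∘ sym ∘ d≡0⇒≡)))
      walk = reverse (geodesic i y) ++ geodesic i (gate l)
      j∉walk : j ∉ʷ walk
      j∉walk j∈ with ∈ʷ-++⁻ (reverse (geodesic i y)) j∈
      ... | inj₁ j∈y = ℕ.≤⇒≯ (on-geodesic⇒≤ (∈ʷ-reverse⁻ _ j∈y)) i-closer
      ... | inj₂ j∈w = ℕ.≤⇒≯ (on-geodesic⇒≤ j∈w) gate-closer

module Summation {c ℓ : Level} (R : CommutativeRing c ℓ) where
  open CommutativeRing R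
  open RawSemiringDefinitions (Semiring.rawSemiring semiring) using (sum) renaming (_×_ to _·_)
  open import Algebra.Properties.Semiring.Sum semiring
    using (sum-cong-≋; ∑-distrib-+; sum-remove; sum-replicate-zero; *-distribˡ-sum)
  open IntegerRingSolver R
  open import Algebra.Properties.Ring ring using (-1*x≈-x)
  open import Relation.Binary.Reasoning.Setoid setoid

  sum-cong : ∀ {n} {f g : Fin n → Carrier} → (∀ j → f j ≈ g j) → sum f ≈ sum g
  sum-cong = sum-cong-≋

  guard : Bool → Carrier → Carrier
  guard b x = if b then x else 0#

  sum-guard : ∀ {n} (S : Subset n) x → sum (λ j → guard (lookup S j) x) ≈ (∣ S ∣ · 1#) * x
  sum-guard []          x = sym (zeroˡ x)
  sum-guard (true ∷ S)  x = begin
    x + sum (λ j → guard (lookup S j) x)  ≈⟨ +-cong (sym (*-identityˡ x)) (sum-guard S x) ⟩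
    1# * x + (∣ S ∣ · 1#) * x            ≈⟨ distribʳ x 1# _ ⟨
    (1# + ∣ S ∣ · 1#) * x                ∎
  sum-guard (false ∷ S) x = trans (+-identityˡ _) (sum-guard S x)

  sum-guard-singleton : ∀ {n} (w : Fin n) x → sum (λ j → guard (lookup ⁅ w ⁆ j) x) ≈ x
  sum-guard-singleton w x = begin
    sum (λ j → guard (lookup ⁅ w ⁆ j) x)  ≈⟨ sum-guard ⁅ w ⁆ x ⟩
    (∣ ⁅ w ⁆ ∣ · 1#) * x                   ≡⟨ ≡.cong (λ k → (k · 1#) * x) (∣⁅x⁆∣≡1 w) ⟩
    (1# + 0#) * x                           ≈⟨ *-congʳ (+-identityʳ 1#) ⟩
    1# * x                                  ≈⟨ *-identityˡ x ⟩
    x                                       ∎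

  sum-single : ∀ {n} (f : Fin n → Carrier) i → (∀ j → j ≢ i → f j ≈ 0#) → sum f ≈ f i
  sum-single {suc n} f i vanishes = begin
    sum f                                  ≈⟨ sum-remove f ⟩
    f i + sum (λ j → f (Fin.punchIn i j))  ≈⟨ +-congˡ (sum-cong (λ j → vanishes _ (punchInᵢ≢i i j))) ⟩
    f i + sum {n} (λ _ → 0#)               ≈⟨ +-congˡ (sum-replicate-zero n) ⟩
    f i + 0#                               ≈⟨ +-identityʳ (f i) ⟩
    f i                                    ∎

  sum-neg : ∀ {n} (f : Fin n → Carrier) → sum (λ j → - f j) ≈ - sum f
  sum-neg f = begin
    sum (λ j → - f j)        ≈⟨ sum-cong (λ j → -1*x≈-x (f j)) ⟨
    sum (λ j → - 1# * f j)   ≈⟨ *-distribˡ-sum (- 1#) f ⟨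
    - 1# * sum f             ≈⟨ -1*x≈-x (sum f) ⟩
    - sum f                  ∎

  sum-minus : ∀ {n} (f g : Fin n → Carrier) → sum (λ j → f j - g j) ≈ sum f - sum g
  sum-minus f g = trans (∑-distrib-+ f (λ j → - g j)) (+-congˡ (sum-neg g))

  sum-guards : ∀ {n} (P Q : Subset n) w x y →
               sum (λ j → guard (lookup P j) x + guard (lookup Q j) y - guard (lookup ⁅ w ⁆ j) 1#)
               ≈ (∣ P ∣ · 1#) * x + (∣ Q ∣ · 1#) * y - 1#
  sum-guards P Q w x y = begin
    sum (λ j → guard (lookup P j) x + guard (lookup Q j) y - guard (lookup ⁅ w ⁆ j) 1#)
      ≈⟨ sum-minus (λ j → guard (lookup P j) x + guard (lookup Q j) y) (λ j → guard (lookup ⁅ w ⁆ j) 1#) ⟩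
    sum (λ j → guard (lookup P j) x + guard (lookup Q j) y) - sum (λ j → guard (lookup ⁅ w ⁆ j) 1#)
      ≈⟨ +-cong (∑-distrib-+ (λ j → guard (lookup P j) x) (λ j → guard (lookup Q j) y))
                (-‿cong (sum-guard-singleton w 1#)) ⟩
    sum (λ j → guard (lookup P j) x) + sum (λ j → guard (lookup Q j) y) - 1#
      ≈⟨ +-congʳ (+-cong (sum-guard P x) (sum-guard Q y)) ⟩
    (∣ P ∣ · 1#) * x + (∣ Q ∣ · 1#) * y - 1#
      ∎

  sum-weighted-guards : ∀ {n} {P Q : Subset n} {w} (E : Fin n → Carrier) c x y →
    w ∈ P → (∀ {j} → j ∈ P → j ∉ Q) →
    E w ≈ 0# → (∀ {j} → j ∈ P → j ≢ w → E j ≈ c) → (∀ {j} → j ∈ Q → E j ≈ 1#) →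
    sum (λ j → E j * (guard (lookup P j) x + guard (lookup Q j) y - guard (lookup ⁅ w ⁆ j) 1#))
    ≈ c * ((∣ P ∣ · 1#) * x - x) + (∣ Q ∣ · 1#) * y
  sum-weighted-guards {P = P} {Q} {w} E c x y w∈P P∩Q=∅ E-w E-P E-Q = begin
    sum (λ j → E j * (guard (lookup P j) x + guard (lookup Q j) y - guard (lookup ⁅ w ⁆ j) 1#))
      ≈⟨ sum-cong pointwise ⟩
    sum (λ j → c * (guard (lookup P j) x - guard (lookup ⁅ w ⁆ j) x) + guard (lookup Q j) y)
      ≈⟨ ∑-distrib-+ (λ j → c * (guard (lookup P j) x - guard (lookup ⁅ w ⁆ j) x))
                     (λ j → guard (lookup Q j) y) ⟩
    sum (λ j → c * (guard (lookup P j) x - guard (lookup ⁅ w ⁆ j) x)) + sum (λ j → guard (lookup Q j) y)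
      ≈⟨ +-cong (sym (*-distribˡ-sum c (λ j → guard (lookup P j) x - guard (lookup ⁅ w ⁆ j) x)))
                (sum-guard Q y) ⟩
    c * sum (λ j → guard (lookup P j) x - guard (lookup ⁅ w ⁆ j) x) + (∣ Q ∣ · 1#) * y
      ≈⟨ +-congʳ (*-congˡ (trans (sum-minus (λ j → guard (lookup P j) x) (λ j → guard (lookup ⁅ w ⁆ j) x))
                                 (+-cong (sum-guard P x) (-‿cong (sum-guard-singleton w x))))) ⟩
    c * ((∣ P ∣ · 1#) * x - x) + (∣ Q ∣ · 1#) * y
      ∎
    where
    pointwise : ∀ j → E j * (guard (lookup P j) x + guard (lookup Q j) y - guard (lookup ⁅ w ⁆ j) 1#)
                      ≈ c * (guard (lookup P j) x - guard (lookup ⁅ w ⁆ j) x) + guard (lookup Q j) y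
    pointwise j with j Fin.≟ w
    ... | yes ≡.refl
      rewrite []=⇒lookup w∈P | ∉⇒lookup≡false (P∩Q=∅ w∈P) | []=⇒lookup (x∈⁅x⁆ w) =
      trans (*-congʳ E-w) (solve 2 (λ c x → :0 :* (x :+ :0 :- :1) := c :* (x :- x) :+ :0) refl c x)
    ... | no j≢w with j ∈? P | j ∈? Q
    ...   | yes j∈P | _ 
      rewrite []=⇒lookup j∈P | ∉⇒lookup≡false (P∩Q=∅ j∈P) | ∉⇒lookup≡false (j≢w ∘ x∈⁅y⁆⇒x≡y w) =
      trans (*-congʳ (E-P j∈P j≢w)) (solve 2 (λ c x → c :* (x :+ :0 :- :0) := c :* (x :- :0) :+ :0) refl c x)
    ...   | no j∉P | yes j∈Q
      rewrite ∉⇒lookup≡false j∉P | []=⇒lookup j∈Q | ∉⇒lookup≡false (j≢w ∘ x∈⁅y⁆⇒x≡y w) =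
      trans (*-congʳ (E-Q j∈Q)) (solve 2 (λ c y → :1 :* (:0 :+ y :- :0) := c :* (:0 :- :0) :+ y) refl c y)
    ...   | no j∉P | no j∉Q
      rewrite ∉⇒lookup≡false j∉P | ∉⇒lookup≡false j∉Q | ∉⇒lookup≡false (j≢w ∘ x∈⁅y⁆⇒x≡y w) =
      solve 2 (λ e c → e :* (:0 :+ :0 :- :0) := c :* (:0 :- :0) :+ :0) refl (E j) c

module QIntegers {c ℓ : Level} (F : Field c ℓ) where
  open Field F
  open RawSemiringDefinitions (Semiring.rawSemiring semiring) using (_^_)
  open import Algebra.Properties.Semiring.Exp semiring using (^-homo-*)
  open IntegerRingSolver commutativeRing
  open import Relation.Binary.Reasoning.Setoid setoid

  qint-+ : ∀ q a b → qint F q (a ℕ.+ b) ≈ qint F q a + q ^ a * qint F q b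
  qint-+ q a zero = begin
    qint F q (a ℕ.+ 0)        ≡⟨ ≡.cong (qint F q) (ℕ.+-identityʳ a) ⟩
    qint F q a                ≈⟨ solve 2 (λ s t → s := s :+ t :* :0) refl (qint F q a) (q ^ a) ⟩
    qint F q a + q ^ a * 0#   ∎
  qint-+ q a (suc b) = begin
    qint F q (a ℕ.+ suc b)                              ≡⟨ ≡.cong (qint F q) (ℕ.+-suc a b) ⟩
    qint F q (a ℕ.+ b) + q ^ (a ℕ.+ b)                  ≈⟨ +-cong (qint-+ q a b) (^-homo-* q a b) ⟩
    (qint F q a + q ^ a * qint F q b) + q ^ a * q ^ b
      ≈⟨ solve 4 (λ s t u v → (s :+ t :* u) :+ t :* v := s :+ t :* (u :+ v))
                 refl (qint F q a) (q ^ a) (qint F q b) (q ^ b) ⟩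
    qint F q a + q ^ a * (qint F q b + q ^ b)           ∎

  qint-geometric : ∀ q D → qint F q D * (1# - q) + q ^ D ≈ 1#
  qint-geometric q zero    = solve 1 (λ q → :0 :* (:1 :- q) :+ :1 := :1) refl q
  qint-geometric q (suc D) = trans
    (solve 3 (λ s t q → (s :+ t) :* (:1 :- q) :+ q :* t := s :* (:1 :- q) :+ t) refl (qint F q D) (q ^ D) q)
    (qint-geometric q D)

  qint-1 : ∀ q → qint F q 1 ≈ 1#
  qint-1 q = +-identityˡ 1#

  qint-2 : ∀ q → qint F q 2 ≈ 1# + q
  qint-2 q = solve 1 (λ q → (:0 :+ :1) :+ q :* :1 := :1 :+ q) refl q

module BlockWeights {c ℓ : Level} (F : Field c ℓ) (q : Field.Carrier F) where
  open Field F
  open RawSemiringDefinitions (Semiring.rawSemiring semiring) using (_^_)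
  open import Algebra.Properties.Semiring.Mult semiring using (×1-homo-*)
  open IntegerRingSolver commutativeRing
  open import Relation.Binary.Reasoning.Setoid setoid

  denominator weightX weightY weightλ : ℕ → ℕ → Carrier
  denominator m n = (q + 1#) * Δ F q m n
  weightX m n = _/_ F (q * ι F (n ∸ 1) - 1#) (denominator m n)
  weightY m n = _/_ F (q * ι F (m ∸ 1) - 1#) (denominator m n)
  weightλ m n = _/_ F ((q + 1#) ^ 2 * ι F ((m ∸ 1) ℕ.* (n ∸ 1)) - ι F (m ℕ.* n)) (denominator m n)

  private
    xNumᴾ yNumᴾ λNumᴾ denᴾ : ∀ {k} → Polynomial k → Polynomial k → Polynomial k → Polynomial k
    xNumᴾ q M N = q :* (N :- :1) :- :1
    yNumᴾ q M N = q :* (M :- :1) :- :1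
    λNumᴾ q M N = (q :+ :1) :* ((q :+ :1) :* :1) :* ((M :- :1) :* (N :- :1)) :- M :* N
    denᴾ  q M N = (q :+ :1) :* (q :* (q :* :1) :* ((M :- :1) :* (N :- :1)) :- :1)

    ι-pred : ∀ {m} → 1 ≤ m → ι F (m ∸ 1) ≈ ι F m - 1#
    ι-pred {suc m} _ = solve 1 (λ M → M := (:1 :+ M) :- :1) refl (ι F m)

    module Unfolded {m n} (1≤m : 1 ≤ m) (1≤n : 1 ≤ n) where
      M N inv xNum yNum λNum den : Carrier
      M     = ι F m
      N     = ι F n
      inv   = denominator m n ⁻¹
      xNum  = q * (N - 1#) - 1#
      yNum  = q * (M - 1#) - 1#
      λNum  = (q + 1#) * ((q + 1#) * 1#) * ((M - 1#) * (N - 1#)) - M * N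
      den   = (q + 1#) * (q * (q * 1#) * ((M - 1#) * (N - 1#)) - 1#)

      weightX≈ : weightX m n ≈ xNum * inv
      weightX≈ = *-congʳ (+-congʳ (*-congˡ (ι-pred 1≤n)))

      weightY≈ : weightY m n ≈ yNum * inv
      weightY≈ = *-congʳ (+-congʳ (*-congˡ (ι-pred 1≤m)))

      ι-[m-1][n-1] : ι F ((m ∸ 1) ℕ.* (n ∸ 1)) ≈ (M - 1#) * (N - 1#)
      ι-[m-1][n-1] = trans (×1-homo-* (m ∸ 1) (n ∸ 1)) (*-cong (ι-pred 1≤m) (ι-pred 1≤n))

      weightλ≈ : weightλ m n ≈ λNum * inv
      weightλ≈ = *-congʳ (+-cong (*-congˡ ι-[m-1][n-1]) (-‿cong (×1-homo-* m n)))

      denominator≈ : denominator m n ≈ den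
      denominator≈ = *-congˡ (+-congʳ (*-congˡ ι-[m-1][n-1]))

    x*y≈0⇒y≈0 : ∀ {x y} → ¬ (x ≈ 0#) → x * y ≈ 0# → y ≈ 0#
    x*y≈0⇒y≈0 {x} {y} x≉0 xy≈0 = begin
      y                   ≈⟨ *-identityˡ y ⟨
      1# * y              ≈⟨ *-congʳ (⁻¹-inverse x x≉0) ⟨
      (x * x ⁻¹) * y      ≈⟨ solve 3 (λ x x′ y → (x :* x′) :* y := x′ :* (x :* y)) refl x (x ⁻¹) y ⟩
      x ⁻¹ * (x * y)      ≈⟨ *-congˡ xy≈0 ⟩
      x ⁻¹ * 0#           ≈⟨ zeroʳ (x ⁻¹) ⟩
      0#                  ∎

    denominator≉0 : ∀ {m n} → ¬ (q + 1# ≈ 0#) → ¬ (qmn F q m n ≈ 1#) → ¬ (denominator m n ≈ 0#)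
    denominator≉0 {m} {n} q+1≉0 qmn≉1 denominator≈0 = qmn≉1 (begin
      qmn F q m n             ≈⟨ solve 1 (λ z → z := (z :- :1) :+ :1) refl (qmn F q m n) ⟩
      Δ F q m n + 1#          ≈⟨ +-congʳ (x*y≈0⇒y≈0 q+1≉0 denominator≈0) ⟩
      0# + 1#                 ≈⟨ +-identityˡ 1# ⟩
      1#                      ∎)

  gate-in-X : ∀ {m n} → 1 ≤ m → 1 ≤ n →
              (1# + q) * (ι F m * weightX m n - weightX m n) + ι F n * weightY m n ≈ weightλ m n
  gate-in-X {m} {n} 1≤m 1≤n = begin
    (1# + q) * (M * weightX m n - weightX m n) + N * weightY m n
      ≈⟨ +-cong (*-congˡ (+-cong (*-congˡ weightX≈) (-‿cong weightX≈))) (*-congˡ weightY≈) ⟩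
    (1# + q) * (M * (xNum * inv) - xNum * inv) + N * (yNum * inv)
      ≈⟨ solve 4 (λ q M N i → (:1 :+ q) :* (M :* (xNumᴾ q M N :* i) :- xNumᴾ q M N :* i) :+ N :* (yNumᴾ q M N :* i)
                           := λNumᴾ q M N :* i) refl q M N inv ⟩
    λNum * inv
      ≈⟨ weightλ≈ ⟨
    weightλ m n
      ∎
    where open Unfolded 1≤m 1≤n

  gate-in-Y : ∀ {m n} → 1 ≤ m → 1 ≤ n →
              (1# + q) * (ι F n * weightY m n - weightY m n) + ι F m * weightX m n ≈ weightλ m n
  gate-in-Y {m} {n} 1≤m 1≤n = begin
    (1# + q) * (N * weightY m n - weightY m n) + M * weightX m n
      ≈⟨ +-cong (*-congˡ (+-cong (*-congˡ weightY≈) (-‿cong weightY≈))) (*-congˡ weightX≈) ⟩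
    (1# + q) * (N * (yNum * inv) - yNum * inv) + M * (xNum * inv)
      ≈⟨ solve 4 (λ q M N i → (:1 :+ q) :* (N :* (yNumᴾ q M N :* i) :- yNumᴾ q M N :* i) :+ M :* (xNumᴾ q M N :* i)
                           := λNumᴾ q M N :* i) refl q M N inv ⟩
    λNum * inv
      ≈⟨ weightλ≈ ⟨
    weightλ m n
      ∎
    where open Unfolded 1≤m 1≤n

  weights-sum : ∀ {m n} → 1 ≤ m → 1 ≤ n → ¬ (q + 1# ≈ 0#) → ¬ (qmn F q m n ≈ 1#) →
                ι F m * weightX m n + ι F n * weightY m n - 1# ≈ (1# - q) * weightλ m n
  weights-sum {m} {n} 1≤m 1≤n q+1≉0 qmn≉1 = begin
    M * weightX m n + N * weightY m n - 1#
      ≈⟨ +-cong (+-cong (*-congˡ weightX≈) (*-congˡ weightY≈)) (-‿cong (sym den*inv≈1)) ⟩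
    M * (xNum * inv) + N * (yNum * inv) - den * inv
      ≈⟨ solve 4 (λ q M N i → M :* (xNumᴾ q M N :* i) :+ N :* (yNumᴾ q M N :* i) :- denᴾ q M N :* i
                           := (:1 :- q) :* (λNumᴾ q M N :* i)) refl q M N inv ⟩
    (1# - q) * (λNum * inv)
      ≈⟨ *-congˡ weightλ≈ ⟨
    (1# - q) * weightλ m n
      ∎
    where
    open Unfolded 1≤m 1≤n
    den*inv≈1 : den * inv ≈ 1#
    den*inv≈1 = trans (*-congʳ (sym denominator≈)) (⁻¹-inverse _ (denominator≉0 {m} {n} q+1≉0 qmn≉1))

module QDistanceEigenvector {c ℓ : Level} (F : Field c ℓ) {N r : ℕ} (G : Graph N)
    (X Y : Fin r → Subset N) (biBlock : IsBiBlock G r X Y)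
    (d : Fin N → Fin N → ℕ) (d-isDistance : ∀ u v → IsDistance G u v (d u v))
    (q : Field.Carrier F) (i : Fin N) where
  open Field F
  open RawSemiringDefinitions (Semiring.rawSemiring semiring) using (sum; _^_)
  open import Algebra.Properties.Semiring.Sum semiring using (∑-distrib-+; *-distribˡ-sum)
  open IntegerRingSolver commutativeRing
  open Summation commutativeRing
  open QIntegers F
  open BlockWeights F q
  open IsBiBlock biBlock
  open Distances G d d-isDistance
  open BiBlockGeometry G X Y biBlock d d-isDistance
  open Gates i
  open import Relation.Binary.Reasoning.Setoid setoid

  a b λ-summand : Fin r → Carrier
  a k         = weightX (m F X Y k) (n F X Y k)
  b k         = weightY (m F X Y k) (n F X Y k)
  λ-summand k = weightλ (m F X Y k) (n F X Y k)

  in-block at-gate : Fin r → Fin N → Carrier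
  in-block k j = guard (lookup (B k) j) 1#
  at-gate  k j = guard (lookup ⁅ gate k ⁆ j) 1#

  ψ : Fin r → Fin N → Carrier
  ψ k j = guard (lookup (X k) j) (a k) + guard (lookup (Y k) j) (b k) - at-gate k j

  ∉B⇒∉gate : ∀ {k j} → j ∉ B k → j ∉ ⁅ gate k ⁆
  ∉B⇒∉gate {k} j∉B j∈w = j∉B (≡.subst (_∈ B k) (≡.sym (x∈⁅y⁆⇒x≡y (gate k) j∈w)) (gate∈B k))

  dhat-sum : ∀ j → ι F (dhat F X Y q j) ≈ sum (λ k → in-block k j)
  dhat-sum j = begin
    ι F (dhat F X Y q j)                    ≈⟨ *-identityʳ _ ⟨
    ι F (dhat F X Y q j) * 1#               ≈⟨ sum-guard (tabulate (λ k → lookup (B k) j)) 1# ⟨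
    sum (λ k → guard (lookup (tabulate (λ k → lookup (B k) j)) k) 1#)
      ≈⟨ sum-cong (λ k → reflexive (≡.cong (λ b → guard b 1#) (lookup∘tabulate (λ k → lookup (B k) j) k))) ⟩
    sum (λ k → in-block k j)                ∎

  non-gate-count : ∀ {j} → j ≢ i → sum (λ k → in-block k j - at-gate k j) ≈ 1#
  non-gate-count {j} j≢i with non-gate-block j≢i
  ... | k₀ , j∈B₀ , j≢w₀ = trans (sum-single (λ k → in-block k j - at-gate k j) k₀ vanishes) at-k₀
    where
    at-k₀ : in-block k₀ j - at-gate k₀ j ≈ 1#
    at-k₀ rewrite []=⇒lookup j∈B₀ | ∉⇒lookup≡false (j≢w₀ ∘ x∈⁅y⁆⇒x≡y (gate k₀)) =
      solve 0 (:1 :- :0 := :1) refl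

    vanishes : ∀ k → k ≢ k₀ → in-block k j - at-gate k j ≈ 0#
    vanishes k k≢k₀ with j ∈? B k | j Fin.≟ gate k
    ... | no j∉B | _ rewrite ∉⇒lookup≡false j∉B | ∉⇒lookup≡false (∉B⇒∉gate j∉B)
                             = solve 0 (:0 :- :0 := :0) refl
    ... | yes j∈B | no j≢w   = ⊥-elim (k≢k₀ (non-gate-block-unique j∈B j≢w j∈B₀ j≢w₀))
    ... | yes j∈B | yes ≡.refl rewrite []=⇒lookup j∈B | []=⇒lookup (x∈⁅x⁆ (gate k))
                             = solve 0 (:1 :- :1 := :0) refl

  gate-count : ∀ {j} → j ≢ i → sum (λ k → at-gate k j) ≈ ι F (dhat F X Y q j) - 1#
  gate-count {j} j≢i = begin
    sum (λ k → at-gate k j)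
      ≈⟨ solve 2 (λ g b → g := b :- (b :- g)) refl (sum (λ k → at-gate k j)) (sum (λ k → in-block k j)) ⟩
    sum (λ k → in-block k j) - (sum (λ k → in-block k j) - sum (λ k → at-gate k j))
      ≈⟨ +-congˡ (-‿cong (sum-minus (λ k → in-block k j) (λ k → at-gate k j))) ⟨
    sum (λ k → in-block k j) - sum (λ k → in-block k j - at-gate k j)
      ≈⟨ +-cong (dhat-sum j) (-‿cong (sym (non-gate-count j≢i))) ⟨
    ι F (dhat F X Y q j) - 1#
      ∎

  xvec-decomposition : ∀ {j} → j ≢ i → xvec F X Y q j ≈ sum (λ k → ψ k j)
  xvec-decomposition {j} j≢i = begin
    sum aX + sum bY - (ι F (dhat F X Y q j) - 1#)     ≈⟨ +-congˡ (-‿cong (gate-count j≢i)) ⟨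
    sum aX + sum bY - sum (λ k → at-gate k j)        ≈⟨ +-congʳ (∑-distrib-+ aX bY) ⟨
    sum (λ k → aX k + bY k) - sum (λ k → at-gate k j) ≈⟨ sum-minus (λ k → aX k + bY k) (λ k → at-gate k j) ⟨
    sum (λ k → ψ k j)                                ∎
    where
    aX bY : Fin r → Carrier
    aX k = guard (lookup (X k) j) (a k)
    bY k = guard (lookup (Y k) j) (b k)

  weighted-xvec : ∀ j → qint F q (d i j) * xvec F X Y q j ≈ qint F q (d i j) * sum (λ k → ψ k j)
  weighted-xvec j with j Fin.≟ i
  ... | no  j≢i    = *-congˡ (xvec-decomposition j≢i)
  ... | yes ≡.refl rewrite d-refl j = trans (zeroˡ _) (sym (zeroˡ _))

  module _ (k : Fin r) where
    private
      w = gate k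
      D = d i w

      E : Fin N → Carrier
      E j = qint F q (d w j)

      E-gate : E w ≈ 0#
      E-gate = reflexive (≡.cong (qint F q) (d-refl w))

      E-same-side : ∀ {j} → SameSide k w j → j ≢ w → E j ≈ 1# + q
      E-same-side same j≢w = trans (reflexive (≡.cong (qint F q) (d-same-side same (j≢w ∘ ≡.sym)))) (qint-2 q)

      E-opposite : ∀ {j} → Opposite k w j → E j ≈ 1#
      E-opposite opp = trans (reflexive (≡.cong (qint F q) (d-opposite opp))) (qint-1 q)

      1≤∣_∣ : ∀ {S : Subset N} → Nonempty S → 1 ≤ ∣ S ∣
      1≤∣ x , x∈S ∣ = ℕ.≤-<-trans z≤n (x∈p⇒∣p-x∣<∣p∣ x∈S)

      1≤m : 1 ≤ m F X Y k
      1≤m = 1≤∣ X-nonempty k ∣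

      1≤n : 1 ≤ n F X Y k
      1≤n = 1≤∣ Y-nonempty k ∣

    ψ-outside : ∀ {j} → j ∉ B k → ψ k j ≈ 0#
    ψ-outside {j} j∉B
      rewrite ∉⇒lookup≡false (j∉B ∘ X⊆B) | ∉⇒lookup≡false (j∉B ∘ Y⊆B)
            | ∉⇒lookup≡false (∉B⇒∉gate j∉B) = solve 0 (:0 :+ :0 :- :0 := :0) refl

    through-gate : ∀ j → qint F q (d i j) * ψ k j ≈ qint F q D * ψ k j + q ^ D * (E j * ψ k j)
    through-gate j with j ∈? B k
    ... | yes j∈B = begin
      qint F q (d i j) * ψ k j                   ≡⟨ ≡.cong (λ e → qint F q e * ψ k j) (d-via-gate j∈B) ⟩
      qint F q (D ℕ.+ d w j) * ψ k j             ≈⟨ *-congʳ (qint-+ q D (d w j)) ⟩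
      (qint F q D + q ^ D * E j) * ψ k j
        ≈⟨ solve 4 (λ s t e p → (s :+ t :* e) :* p := s :* p :+ t :* (e :* p))
                   refl (qint F q D) (q ^ D) (E j) (ψ k j) ⟩
      qint F q D * ψ k j + q ^ D * (E j * ψ k j) ∎
    ... | no j∉B = begin
      qint F q (d i j) * ψ k j                   ≈⟨ *-congˡ (ψ-outside j∉B) ⟩
      qint F q (d i j) * 0#
        ≈⟨ solve 4 (λ s s′ t e → s :* :0 := s′ :* :0 :+ t :* (e :* :0))
                   refl (qint F q (d i j)) (qint F q D) (q ^ D) (E j) ⟩
      qint F q D * 0# + q ^ D * (E j * 0#)       ≈⟨ +-cong (*-congˡ ψ≈0) (*-congˡ (*-congˡ ψ≈0)) ⟨
      qint F q D * ψ k j + q ^ D * (E j * ψ k j) ∎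
      where ψ≈0 = ψ-outside j∉B

    sum-from-gate : sum (λ j → E j * ψ k j) ≈ λ-summand k
    sum-from-gate with x∈p∪q⁻ (X k) (Y k) (gate∈B k)
    ... | inj₁ w∈X = begin
      sum (λ j → E j * ψ k j)
        ≈⟨ sum-weighted-guards E (1# + q) (a k) (b k) w∈X X∩Y-empty E-gate
             (λ j∈X → E-same-side (inj₁ (w∈X , j∈X))) (λ j∈Y → E-opposite (inj₁ (w∈X , j∈Y))) ⟩
      (1# + q) * (ι F (m F X Y k) * a k - a k) + ι F (n F X Y k) * b k
        ≈⟨ gate-in-X 1≤m 1≤n ⟩
      λ-summand k
        ∎
    ... | inj₂ w∈Y = begin
      sum (λ j → E j * ψ k j)
        ≈⟨ sum-cong (λ j → *-congˡ (+-congʳ (+-comm (guard (lookup (X k) j) (a k))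
                                                    (guard (lookup (Y k) j) (b k))))) ⟩
      sum (λ j → E j * (guard (lookup (Y k) j) (b k) + guard (lookup (X k) j) (a k) - at-gate k j))
        ≈⟨ sum-weighted-guards E (1# + q) (b k) (a k) w∈Y (λ j∈Y j∈X → X∩Y-empty j∈X j∈Y) E-gate
             (λ j∈Y → E-same-side (inj₂ (w∈Y , j∈Y))) (λ j∈X → E-opposite (inj₂ (w∈Y , j∈X))) ⟩
      (1# + q) * (ι F (n F X Y k) * b k - b k) + ι F (m F X Y k) * a k
        ≈⟨ gate-in-Y 1≤m 1≤n ⟩
      λ-summand k
        ∎

    block-sum : ¬ (q + 1# ≈ 0#) → ¬ (qmn F q (m F X Y k) (n F X Y k) ≈ 1#) →
                sum (λ j → qint F q (d i j) * ψ k j) ≈ λ-summand k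
    block-sum q+1≉0 qmn≉1 = begin
      sum (λ j → qint F q (d i j) * ψ k j)
        ≈⟨ sum-cong through-gate ⟩
      sum (λ j → qint F q D * ψ k j + q ^ D * (E j * ψ k j))
        ≈⟨ ∑-distrib-+ (λ j → qint F q D * ψ k j) (λ j → q ^ D * (E j * ψ k j)) ⟩
      sum (λ j → qint F q D * ψ k j) + sum (λ j → q ^ D * (E j * ψ k j))
        ≈⟨ +-cong (*-distribˡ-sum (qint F q D) (ψ k)) (*-distribˡ-sum (q ^ D) (λ j → E j * ψ k j)) ⟨
      qint F q D * sum (ψ k) + q ^ D * sum (λ j → E j * ψ k j)
        ≈⟨ +-cong (*-congˡ (trans (sum-guards (X k) (Y k) w (a k) (b k)) (weights-sum 1≤m 1≤n q+1≉0 qmn≉1)))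
                  (*-congˡ sum-from-gate) ⟩
      qint F q D * ((1# - q) * λ-summand k) + q ^ D * λ-summand k
        ≈⟨ solve 4 (λ s t q l → s :* ((:1 :- q) :* l) :+ t :* l := (s :* (:1 :- q) :+ t) :* l)
                   refl (qint F q D) (q ^ D) q (λ-summand k) ⟩
      (qint F q D * (1# - q) + q ^ D) * λ-summand k
        ≈⟨ *-congʳ (qint-geometric q D) ⟩
      1# * λ-summand k
        ≈⟨ *-identityˡ (λ-summand k) ⟩
      λ-summand k
        ∎

lemma4p4 : {c ℓ : Level} (F : Field c ℓ) {N r : ℕ} (G : Graph N)
           (X Y : Fin r → Subset N) → IsBiBlock G r X Y →
           (d : Fin N → Fin N → ℕ) → (∀ u v → IsDistance G u v (d u v)) →
           (q : Field.Carrier F) →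
           ¬ (Field._≈_ F q (Field.0# F)) →
           ¬ (Field._≈_ F (Field._+_ F q (Field.1# F)) (Field.0# F)) →
           (∀ k → ¬ (Field._≈_ F (qmn F q (m F X Y k) (n F X Y k)) (Field.1# F))) →
           ∀ i → Field._≈_ F (mulVec F (qDist F q d) (xvec F X Y q) i) (λG F X Y q)
lemma4p4 F G X Y biBlock d d-isDistance q _ q+1≉0 qmn≉1 i = begin
  sum (λ j → qint F q (d i j) * xvec F X Y q j)
    ≈⟨ sum-cong weighted-xvec ⟩
  sum (λ j → qint F q (d i j) * sum (λ k → ψ k j))
    ≈⟨ sum-cong (λ j → *-distribˡ-sum (qint F q (d i j)) (λ k → ψ k j)) ⟩
  sum (λ j → sum (λ k → qint F q (d i j) * ψ k j))
    ≈⟨ ∑-comm (λ j k → qint F q (d i j) * ψ k j) ⟩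
  sum (λ k → sum (λ j → qint F q (d i j) * ψ k j))
    ≈⟨ sum-cong (λ k → block-sum k q+1≉0 (qmn≉1 k)) ⟩
  sum λ-summand
    ∎
  where
  open Field F
  open RawSemiringDefinitions (Semiring.rawSemiring semiring) using (sum)
  open import Algebra.Properties.Semiring.Sum semiring using (∑-comm; *-distribˡ-sum)
  open Summation commutativeRing using (sum-cong)
  open QDistanceEigenvector F G X Y biBlock d d-isDistance q i
  open import Relation.Binary.Reasoning.Setoid setoid
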